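{- Let $\mathbf{f}=\mathbf{f}[0]\mathbf{f}[1]\cdots = 01001010\cdots$ be the Fibonacci word and $F_n$ the Fibonacci numbers. (a) If $n\ge1$ has lazy Fibonacci representation $n = F_{t_1} + F_{t_2} + \cdots + F_{t_r}$ with $t_1<t_2<\cdots<t_r$, then the periods of the length-$n$ prefix of $\mathbf{f}$ (including the trivial period $n$) are exactly $$F_{t_r},\ F_{t_r}+F_{t_{r-1}},\ F_{t_r}+F_{t_{r-1}}+F_{t_{r-2}},\ \ldots,\ F_{t_r}+F_{t_{r-1}}+\cdots+F_{t_1}.$$ (b) For $n\ge1$, the shortest prefix of $\mathbf{f}$ having exactly $n$ periods (including the trivial period) has length $F_{n+3}-2$. (c) For $n\ge1$, the longest prefix of $\mathbf{f}$ having exactly $n$ periods (including the trivial period) has length $F_{2n+2}-1$. (d) For $n\ge2$ and $F_{n+1}-1 \le m \le F_{n+2}-2$, the least period of $\mathbf{f}[0..m-1]$ is $F_n$.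
   Context: The Fibonacci numbers are $F_0=0$, $F_1=1$, $F_n=F_{n-1}+F_{n-2}$. The Fibonacci word $\mathbf{f}$ is the fixed point of the morphism $0\mapsto 01$, $1\mapsto 0$; equivalently it is the characteristic Sturmian word with slope $\alpha=(3-\sqrt5)/2$, indexed here from $0$. The lazy Fibonacci representation of a positive integer $n$ is the unique expression $n=\sum_{0\le i\le t} d_i F_{i+2}$ with each $d_i\in\{0,1\}$, $d_t=1$, and no two consecutive digits $d_{i}, d_{i-1}$ both equal to $0$; writing it as a sum of distinct Fibonacci numbers $F_{t_1}+\cdots+F_{t_r}$ (all indices $\ge2$). An integer $p$ with $1\le p\le |w|$ is a period of a finite word $w$ if $w[i]=w[i+p]$ for all $1\le i\le |w|-p$. -}

module Defs where

open import Data.Nat using (ℕ; zero; suc; _+_; _∸_; _≤_; _<_; _≟_; _≤?_)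
open import Data.Nat.Properties using (allUpTo?)
open import Data.Bool using (Bool; true; false; if_then_else_)
open import Data.List using (List; []; _∷_; _++_; [_]; concatMap; length; filter; upTo; drop)
open import Data.Product using (_×_; ∃; ∃-syntax; _,_)
open import Relation.Binary.PropositionalEquality using (_≡_; _≢_)
open import Relation.Nullary using (Dec)
open import Relation.Nullary.Decidable using (_×-dec_)

F : ℕ → ℕ
F zero = 0
F (suc zero) = 1
F (suc (suc n)) = F (suc n) + F n

φ : List ℕ → List ℕ
φ = concatMap (λ { zero → 0 ∷ 1 ∷ [] ; (suc _) → 0 ∷ [] })

φ^ : ℕ → List ℕ
φ^ zero = 0 ∷ []
φ^ (suc k) = φ (φ^ k)

-- i-th letter of a list (default 0 beyond its end; never used for the word below)
at : List ℕ → ℕ → ℕ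
at [] _ = 0
at (x ∷ xs) zero = x
at (x ∷ xs) (suc i) = at xs i

-- The Fibonacci word f, indexed from 0: f[i] is the i-th letter of φ^(i+1)(0),
-- a prefix of the fixed point of length F (i+3) > i.
fibWord : ℕ → ℕ
fibWord i = at (φ^ (suc i)) i

IsPeriod : ℕ → ℕ → Set
IsPeriod L p = (1 ≤ p) × (p ≤ L) × (∀ {i} → i < L ∸ p → fibWord i ≡ fibWord (i + p))

isPeriod? : ∀ L p → Dec (IsPeriod L p)
isPeriod? L p = (1 ≤? p) ×-dec ((p ≤? L) ×-dec allUpTo? (λ i → fibWord i ≟ fibWord (i + p)) (L ∸ p))

numPeriods : ℕ → ℕ
numPeriods L = length (filter (isPeriod? L) (upTo (suc L)))

-- Fibonacci representations as little-endian digit lists d_0 d_1 … d_t,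
-- digit d_i carrying weight F (i+2).  valFrom k ds = Σ_j d_j F (k+j+2).
valFrom : ℕ → List Bool → ℕ
valFrom k [] = 0
valFrom k (d ∷ ds) = (if d then F (k + 2) else 0) + valFrom (suc k) ds

IsLazyRep : List Bool → ℕ → Set
IsLazyRep ds n =
  (valFrom 0 ds ≡ n)
  × (∃[ xs ] ds ≡ xs ++ [ true ])
  × (∀ xs ys → ds ≢ xs ++ (false ∷ false ∷ ys))

module Submission where

-- Write φ^k for φ^k(0), so that |φ^k| = F (k+2) and φ^(k+2) = φ^(k+1) φ^k.  The
-- words φ^(k+1)φ^k and φ^kφ^(k+1) agree except that their last two letters are
-- swapped.  Reading f through these two factorisations shows that F (k+2) is a
-- period of every prefix of length at most F (k+4) - 2, but not of the prefix of
-- length F (k+4) - 1.  A two-step induction then shows that every period of a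
-- prefix of length at least F (k+1) - 1 is at least F k; together these give (d).
--
-- Hence a prefix of length L = V + F (k+2), with F (k+1) - 1 ≤ V ≤ F (k+3) - 2,
-- has least period F (k+2), and its other periods are exactly F (k+2) + r for the
-- periods r of the prefix of length V ("extension lemma").  Peeling off the leading
-- digit of a lazy representation is an instance of this, which gives (a) by
-- induction.  The extension lemma also adds exactly one period, and every length
-- arises by an extension, so the number of periods grows by one per extension step;
-- bounding the lengths reachable in n steps from both sides gives (b) and (c).

open import Defs
open import Data.Nat using (ℕ; suc; _+_; _*_; _∸_; _≤_)
open import Data.Bool using (Bool; true)
open import Data.List using (List; _∷_; drop)
open import Data.Product using (_×_; ∃-syntax; _,_)
open import Function.Bundles using (_⇔_)
open import Relation.Binary.PropositionalEquality using (_≡_)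

open import Data.Nat using (zero; z≤n; s≤s; _<_; _≤′_; ≤′-refl; ≤′-step; _≤?_)
open import Data.Nat.Properties
open import Data.Nat.Induction using (<-rec)
open import Data.Nat.Tactic.RingSolver using (solve-∀)
open import Data.Bool using (false; if_then_else_)
open import Data.List using ([]; _++_; [_]; _∷ʳ_; length; map; filter; upTo; applyUpTo)
open import Data.List.Properties using (length-++; ++-assoc; filter-++; filter-accept; filter-reject)
open import Data.List.Reverse using (Reverse; []; _∶_∶ʳ_; reverseView)
open import Data.List.Membership.Propositional using (_∈_)
open import Data.List.Membership.Propositional.Properties
  using (∈-map⁺; ∈-map⁻; ∈-++⁺ˡ; ∈-++⁺ʳ; ∈-++⁻)
open import Data.List.Relation.Unary.Any using (here; there)
open import Data.Product using (proj₁; proj₂)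
open import Data.Sum using (inj₁; inj₂)
open import Data.Empty using (⊥-elim)
open import Relation.Nullary using (¬_; yes; no)
open import Relation.Unary using (Pred; Decidable)
open import Relation.Binary.PropositionalEquality
  using (_≢_; refl; sym; trans; cong; cong₂; subst; subst₂; module ≡-Reasoning)
open import Function.Bundles using (mk⇔; Equivalence)
open import Function.Construct.Composition using (_⇔-∘_)
open import Level using (0ℓ)
open ≡-Reasoning

F-pos : ∀ k → 1 ≤ F (suc k)
F-pos zero = s≤s z≤n
F-pos (suc k) = ≤-trans (F-pos k) (m≤m+n (F (suc k)) (F k))

F-step : ∀ n → F n ≤ F (suc n)
F-step zero = z≤n
F-step (suc n) = m≤m+n (F (suc n)) (F n)

F-mono : ∀ {m n} → m ≤ n → F m ≤ F n
F-mono m≤n = go (≤⇒≤′ m≤n)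
  where
  go : ∀ {m n} → m ≤′ n → F m ≤ F n
  go ≤′-refl = ≤-refl
  go (≤′-step {n} m≤′n) = ≤-trans (go m≤′n) (F-step n)

F-strict : ∀ n → F (2 + n) < F (3 + n)
F-strict n = m<m+n (F (2 + n)) (F-pos n)

F-reflect-≤ : ∀ m n → F m ≤ F (2 + n) → m ≤ 2 + n
F-reflect-≤ m n le with m ≤? 2 + n
... | yes m≤ = m≤
... | no m≰ = ⊥-elim (<⇒≱ (<-≤-trans (F-strict n) (F-mono (≰⇒> m≰))) le)

F3≥2 : ∀ k → 2 ≤ F (3 + k)
F3≥2 k = +-mono-≤ (F-pos (suc k)) (F-pos k)

-- F grows at least linearly; this makes φ^(i+1) long enough to contain f[i].
n<F : ∀ n → n < F (2 + n)
n<F zero = s≤s z≤n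
n<F (suc n) = subst (suc (suc n) ≤_) (+-comm (F (suc n)) (F (2 + n))) (+-mono-≤ (F-pos n) (n<F n))

F-suc : ∀ k → ∃[ L ] (suc L ≡ F (suc k))
F-suc k with F (suc k) | F-pos k
... | suc L | _ = L , refl

φ-++ : ∀ xs ys → φ (xs ++ ys) ≡ φ xs ++ φ ys
φ-++ [] ys = refl
φ-++ (zero ∷ xs) ys = cong (λ w → 0 ∷ 1 ∷ w) (φ-++ xs ys)
φ-++ (suc x ∷ xs) ys = cong (0 ∷_) (φ-++ xs ys)

φ^-rec : ∀ k → φ^ (2 + k) ≡ φ^ (suc k) ++ φ^ k
φ^-rec zero = refl
φ^-rec (suc k) = trans (cong φ (φ^-rec k)) (φ-++ (φ^ (suc k)) (φ^ k))

length-φ^ : ∀ k → length (φ^ k) ≡ F (2 + k)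
length-φ^ zero = refl
length-φ^ (suc zero) = refl
length-φ^ (suc (suc k)) = begin
  length (φ^ (2 + k))                  ≡⟨ cong length (φ^-rec k) ⟩
  length (φ^ (suc k) ++ φ^ k)          ≡⟨ length-++ (φ^ (suc k)) ⟩
  length (φ^ (suc k)) + length (φ^ k)  ≡⟨ cong₂ _+_ (length-φ^ (suc k)) (length-φ^ k) ⟩
  F (4 + k)                            ∎

at-++ˡ : ∀ xs ys i → i < length xs → at (xs ++ ys) i ≡ at xs i
at-++ˡ (x ∷ xs) ys zero _ = refl
at-++ˡ (x ∷ xs) ys (suc i) (s≤s i<) = at-++ˡ xs ys i i<

at-++ʳ : ∀ xs ys i → at (xs ++ ys) (length xs + i) ≡ at ys i
at-++ʳ [] ys i = refl
at-++ʳ (x ∷ xs) ys i = at-++ʳ xs ys i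

at-mid : ∀ u a r → at (u ++ a ∷ r) (length u) ≡ a
at-mid [] a r = refl
at-mid (x ∷ u) a r = at-mid u a r

φ^-prefix : ∀ k → ∃[ R ] (φ^ (suc k) ≡ φ^ k ++ R)
φ^-prefix zero = (1 ∷ []) , refl
φ^-prefix (suc k) = φ^ k , φ^-rec k

at-φ^-suc : ∀ k i → i < F (2 + k) → at (φ^ (suc k)) i ≡ at (φ^ k) i
at-φ^-suc k i i< with φ^-prefix k
... | R , eq rewrite eq = at-++ˡ (φ^ k) R i (subst (i <_) (sym (length-φ^ k)) i<)

at-φ^-mono : ∀ {k m} i → k ≤ m → i < F (2 + k) → at (φ^ m) i ≡ at (φ^ k) i
at-φ^-mono {k} i k≤m i< = go (≤⇒≤′ k≤m)
  where
  go : ∀ {m} → k ≤′ m → at (φ^ m) i ≡ at (φ^ k) i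
  go ≤′-refl = refl
  go (≤′-step {m} k≤′m) =
    trans (at-φ^-suc m i (<-≤-trans i< (F-mono (s≤s (s≤s (≤′⇒≤ k≤′m)))))) (go k≤′m)

fibWord-φ^ : ∀ k i → i < F (2 + k) → fibWord i ≡ at (φ^ k) i
fibWord-φ^ k i i< with ≤-total k (suc i)
... | inj₁ k≤ = at-φ^-mono i k≤ i<
... | inj₂ ≤k = sym (at-φ^-mono i ≤k (<⇒≤ (n<F (suc i))))

φ^-swap : ∀ k → ∃[ u ] ∃[ a ] ∃[ b ]
  (a ≢ b × φ^ (suc k) ++ φ^ k ≡ u ++ a ∷ b ∷ [] × φ^ k ++ φ^ (suc k) ≡ u ++ b ∷ a ∷ [])
φ^-swap zero = (0 ∷ []) , 1 , 0 , (λ ()) , refl , refl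
φ^-swap (suc k) with φ^-swap k
... | u , a , b , a≢b , e₁ , e₂ =
  φ^ (suc k) ++ u , b , a , (λ b≡a → a≢b (sym b≡a)) , swapped₁ , swapped₂
  where
  swapped₁ : φ^ (2 + k) ++ φ^ (suc k) ≡ (φ^ (suc k) ++ u) ++ b ∷ a ∷ []
  swapped₁ = begin
    φ^ (2 + k) ++ φ^ (suc k)              ≡⟨ cong (_++ φ^ (suc k)) (φ^-rec k) ⟩
    (φ^ (suc k) ++ φ^ k) ++ φ^ (suc k)    ≡⟨ ++-assoc (φ^ (suc k)) (φ^ k) (φ^ (suc k)) ⟩
    φ^ (suc k) ++ (φ^ k ++ φ^ (suc k))    ≡⟨ cong (φ^ (suc k) ++_) e₂ ⟩
    φ^ (suc k) ++ (u ++ b ∷ a ∷ [])       ≡⟨ ++-assoc (φ^ (suc k)) u _ ⟨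
    (φ^ (suc k) ++ u) ++ b ∷ a ∷ []       ∎
  swapped₂ : φ^ (suc k) ++ φ^ (2 + k) ≡ (φ^ (suc k) ++ u) ++ a ∷ b ∷ []
  swapped₂ = begin
    φ^ (suc k) ++ φ^ (2 + k)              ≡⟨ cong (φ^ (suc k) ++_) (trans (φ^-rec k) e₁) ⟩
    φ^ (suc k) ++ (u ++ a ∷ b ∷ [])       ≡⟨ ++-assoc (φ^ (suc k)) u _ ⟨
    (φ^ (suc k) ++ u) ++ a ∷ b ∷ []       ∎

swap-length : ∀ k u a b → φ^ (suc k) ++ φ^ k ≡ u ++ a ∷ b ∷ [] → length u + 2 ≡ F (3 + k) + F (2 + k)
swap-length k u a b e = begin
  length u + 2                          ≡⟨ length-++ u ⟨
  length (u ++ a ∷ b ∷ [])              ≡⟨ cong length e ⟨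
  length (φ^ (suc k) ++ φ^ k)           ≡⟨ length-++ (φ^ (suc k)) ⟩
  length (φ^ (suc k)) + length (φ^ k)   ≡⟨ cong₂ _+_ (length-φ^ (suc k)) (length-φ^ k) ⟩
  F (3 + k) + F (2 + k)                 ∎

fibWord-in-φ^kφ^k+1 : ∀ k i → i < F (3 + k) → fibWord i ≡ at (φ^ k ++ φ^ (suc k)) (F (2 + k) + i)
fibWord-in-φ^kφ^k+1 k i i< = begin
  fibWord i                                          ≡⟨ fibWord-φ^ (suc k) i i< ⟩
  at (φ^ (suc k)) i                                  ≡⟨ at-++ʳ (φ^ k) (φ^ (suc k)) i ⟨
  at (φ^ k ++ φ^ (suc k)) (length (φ^ k) + i)
    ≡⟨ cong (λ n → at (φ^ k ++ φ^ (suc k)) (n + i)) (length-φ^ k) ⟩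
  at (φ^ k ++ φ^ (suc k)) (F (2 + k) + i)            ∎

fibWord-in-φ^k+1φ^k : ∀ k i → i < F (3 + k) →
  fibWord (i + F (2 + k)) ≡ at (φ^ (suc k) ++ φ^ k) (F (2 + k) + i)
fibWord-in-φ^k+1φ^k k i i< = begin
  fibWord (i + F (2 + k))                    ≡⟨ fibWord-φ^ (2 + k) _ (+-monoˡ-< (F (2 + k)) i<) ⟩
  at (φ^ (2 + k)) (i + F (2 + k))            ≡⟨ cong₂ at (φ^-rec k) (+-comm i (F (2 + k))) ⟩
  at (φ^ (suc k) ++ φ^ k) (F (2 + k) + i)    ∎

F-shift-agrees : ∀ k i → i + 3 ≤ F (3 + k) → fibWord i ≡ fibWord (i + F (2 + k))
F-shift-agrees k i i+3≤ with φ^-swap k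
... | u , a , b , _ , e₁ , e₂ = begin
  fibWord i                                   ≡⟨ fibWord-in-φ^kφ^k+1 k i i< ⟩
  at (φ^ k ++ φ^ (suc k)) (c + i)             ≡⟨ cong (λ w → at w (c + i)) e₂ ⟩
  at (u ++ b ∷ a ∷ []) (c + i)                ≡⟨ at-++ˡ u _ (c + i) inside ⟩
  at u (c + i)                                ≡⟨ at-++ˡ u _ (c + i) inside ⟨
  at (u ++ a ∷ b ∷ []) (c + i)                ≡⟨ cong (λ w → at w (c + i)) e₁ ⟨
  at (φ^ (suc k) ++ φ^ k) (c + i)             ≡⟨ fibWord-in-φ^k+1φ^k k i i< ⟨
  fibWord (i + c)                             ∎
  where
  c = F (2 + k)
  i< : i < F (3 + k)
  i< = <-≤-trans (m<m+n i (s≤s z≤n)) i+3≤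
  rearrange : ∀ c i → c + (i + 3) ≡ suc (c + i) + 2
  rearrange = solve-∀
  inside : c + i < length u
  inside = +-cancelʳ-≤ 2 (suc (c + i)) (length u)
    (subst₂ _≤_ (rearrange c i) (trans (+-comm c (F (3 + k))) (sym (swap-length k u a b e₁)))
      (+-monoʳ-≤ c i+3≤))

F-shift-fails : ∀ k → ∃[ j ] (j + 2 ≡ F (3 + k) × fibWord j ≢ fibWord (j + F (2 + k)))
F-shift-fails k with φ^-swap k
... | u , a , b , a≢b , e₁ , e₂ =
  j , j+2≡ , λ same → a≢b (trans (sym atφ^k+1φ^k) (trans (sym same) atφ^kφ^k+1))
  where
  c = F (2 + k)
  j = F (3 + k) ∸ 2
  j+2≡ : j + 2 ≡ F (3 + k)
  j+2≡ = m∸n+n≡m (F3≥2 k)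
  c+j≡ : c + j ≡ length u
  c+j≡ = +-cancelʳ-≡ 2 (c + j) (length u)
    (trans (+-assoc c j 2) (trans (cong (c +_) j+2≡)
      (trans (+-comm c (F (3 + k))) (sym (swap-length k u a b e₁)))))
  j< : j < F (3 + k)
  j< = subst (j <_) j+2≡ (m<m+n j (s≤s z≤n))
  atφ^kφ^k+1 : fibWord j ≡ b
  atφ^kφ^k+1 = trans (fibWord-in-φ^kφ^k+1 k j j<) (trans (cong₂ at e₂ c+j≡) (at-mid u b _))
  atφ^k+1φ^k : fibWord (j + c) ≡ a
  atφ^k+1φ^k = trans (fibWord-in-φ^k+1φ^k k j j<) (trans (cong₂ at e₁ c+j≡) (at-mid u a _))

zero-not-period : ∀ L → ¬ IsPeriod L 0
zero-not-period L (() , _)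

empty-has-no-period : ∀ p → ¬ IsPeriod 0 p
empty-has-no-period zero = zero-not-period 0
empty-has-no-period (suc p) (_ , () , _)

period-restrict : ∀ {L L′ p} → IsPeriod L p → p ≤ L′ → L′ ≤ L → IsPeriod L′ p
period-restrict {p = p} (1≤p , _ , agree) p≤L′ L′≤L =
  1≤p , p≤L′ , λ i< → agree (<-≤-trans i< (∸-monoˡ-≤ p L′≤L))

period-shift : ∀ {L p r} → IsPeriod L p → 1 ≤ r → IsPeriod L (p + r) ⇔ IsPeriod (L ∸ p) r
period-shift {L} {p} {r} (_ , p≤L , p-agree) 1≤r = mk⇔ to from
  where
  reorder : ∀ i p r → i + (p + r) ≡ i + r + p
  reorder = solve-∀
  to : IsPeriod L (p + r) → IsPeriod (L ∸ p) r
  to (_ , p+r≤L , pr-agree) = 1≤r , r≤L∸p , λ {i} i< →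
    trans (pr-agree (subst (i <_) (∸-+-assoc L p r) i<))
          (trans (cong fibWord (reorder i p r)) (sym (p-agree (m≤o∸n⇒m+n≤o (suc i) r≤L∸p i<))))
    where
    r≤L∸p : r ≤ L ∸ p
    r≤L∸p = m+n≤o⇒m≤o∸n r (subst (_≤ L) (+-comm p r) p+r≤L)
  from : IsPeriod (L ∸ p) r → IsPeriod L (p + r)
  from (_ , r≤L∸p , r-agree) =
    ≤-trans 1≤r (m≤n+m r p) , subst (_≤ L) (+-comm r p) (m≤o∸n⇒m+n≤o r p≤L r≤L∸p) ,
    λ {i} i< → let i<′ = subst (i <_) (sym (∸-+-assoc L p r)) i< in
      trans (r-agree i<′)
            (trans (p-agree (m≤o∸n⇒m+n≤o (suc i) r≤L∸p i<′)) (cong fibWord (sym (reorder i p r))))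

F-period : ∀ k L → F (2 + k) ≤ L → L + 2 ≤ F (4 + k) → IsPeriod L (F (2 + k))
F-period k L c≤L L+2≤ = F-pos (suc k) , c≤L , λ {i} i< →
  F-shift-agrees k i (+-cancelʳ-≤ c (i + 3) (F (3 + k))
    (≤-trans (subst (_≤ L + 2) (reorder i c) (+-monoˡ-≤ 2 (m≤o∸n⇒m+n≤o (suc i) c≤L i<))) L+2≤))
  where
  c = F (2 + k)
  reorder : ∀ i c → suc i + c + 2 ≡ i + 3 + c
  reorder = solve-∀

F-not-period : ∀ k L → suc L ≡ F (4 + k) → ¬ IsPeriod L (F (2 + k))
F-not-period k L sucL≡ (_ , _ , agree) with F-shift-fails k
... | j , j+2≡ , differ = differ (agree (m+n≤o⇒m≤o∸n (suc j) (≤-reflexive (suc-injective fits))))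
  where
  c = F (2 + k)
  reorder : ∀ j c → suc (suc j + c) ≡ j + 2 + c
  reorder = solve-∀
  fits : suc (suc j + c) ≡ suc L
  fits = trans (reorder j c) (trans (cong (_+ c) j+2≡) (sym sucL≡))

PeriodBound : ℕ → Set
PeriodBound k = ∀ L p → F (suc k) ≤ suc L → IsPeriod L p → F k ≤ p

-- On the prefix of length F (k+4) - 1, a period p < F (k+3) must be F (k+2): it is
-- ≥ F (k+2) by the bound for k+2, and since F (k+3) is a period too, F (k+3) - p is
-- a period of a suffix of length ≥ F (k+2) - 1, hence ≥ F (k+1) by the bound for k+1.
short-period-is-F : ∀ k → PeriodBound (1 + k) → PeriodBound (2 + k) →
  ∀ L p → suc L ≡ F (4 + k) → IsPeriod L p → p < F (3 + k) → p ≡ F (2 + k)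
short-period-is-F k bound₁ bound₂ L p sucL≡ hp p<c₃ = ≤-antisym p≤c₂ c₂≤p
  where
  c₂ = F (2 + k)
  c₃ = F (3 + k)
  r = c₃ ∸ p
  c₂≤p : c₂ ≤ p
  c₂≤p = bound₂ L p (subst (c₃ ≤_) (sym sucL≡) (F-step (3 + k))) hp
  p+r≡c₃ : p + r ≡ c₃
  p+r≡c₃ = m+[n∸m]≡n (<⇒≤ p<c₃)
  c₃≤L : c₃ ≤ L
  c₃≤L = ≤-pred (subst (suc c₃ ≤_) (sym sucL≡)
           (subst (_≤ c₃ + c₂) (+-comm c₃ 1) (+-monoʳ-≤ c₃ (F-pos (suc k)))))
  L+2≡ : L + 2 ≡ F (4 + k) + 1
  L+2≡ = trans (+-suc L 1) (cong (_+ 1) sucL≡)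
  hc₃ : IsPeriod L c₃
  hc₃ = F-period (suc k) L c₃≤L
          (subst (_≤ F (5 + k)) (sym L+2≡) (+-monoʳ-≤ (F (4 + k)) (F-pos (2 + k))))
  hr : IsPeriod (L ∸ p) r
  hr = Equivalence.to (period-shift hp (m<n⇒0<n∸m p<c₃)) (subst (IsPeriod L) (sym p+r≡c₃) hc₃)
  suffix-length : suc (L ∸ p) ≡ r + c₂
  suffix-length = begin
    suc (L ∸ p)          ≡⟨ +-∸-assoc 1 (≤-trans (<⇒≤ p<c₃) c₃≤L) ⟨
    suc L ∸ p            ≡⟨ cong (_∸ p) (trans sucL≡ (cong (_+ c₂) (sym p+r≡c₃))) ⟩
    p + r + c₂ ∸ p       ≡⟨ cong (_∸ p) (+-assoc p r c₂) ⟩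
    p + (r + c₂) ∸ p     ≡⟨ m+n∸m≡n p (r + c₂) ⟩
    r + c₂               ∎
  c₁≤r : F (1 + k) ≤ r
  c₁≤r = bound₁ (L ∸ p) r (subst (c₂ ≤_) (sym suffix-length) (m≤n+m c₂ r)) hr
  p≤c₂ : p ≤ c₂
  p≤c₂ = +-cancelʳ-≤ (F (1 + k)) p c₂ (≤-trans (+-monoʳ-≤ p c₁≤r) (≤-reflexive p+r≡c₃))

-- The bounds for k+1 and k+2 give the bound for k+3: a shorter period would,
-- restricted to the prefix of length F (k+4) - 1, be F (k+2), contradicting F-not-period.
period-bound-step : ∀ k → PeriodBound (1 + k) → PeriodBound (2 + k) → PeriodBound (3 + k)
period-bound-step k bound₁ bound₂ L p c₄≤ hp with F (3 + k) ≤? p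
... | yes c₃≤p = c₃≤p
... | no c₃≰p with F-suc (3 + k)
... | L₀ , sucL₀≡ =
  ⊥-elim (F-not-period k L₀ sucL₀≡
    (subst (IsPeriod L₀) (short-period-is-F k bound₁ bound₂ L₀ p sucL₀≡ hp₀ p<c₃) hp₀))
  where
  p<c₃ : p < F (3 + k)
  p<c₃ = ≰⇒> c₃≰p
  hp₀ : IsPeriod L₀ p
  hp₀ = period-restrict hp
    (≤-pred (subst (suc p ≤_) (sym sucL₀≡) (≤-trans p<c₃ (F-step (3 + k)))))
    (≤-pred (subst (_≤ suc L) (sym sucL₀≡) c₄≤))

period-bound : ∀ k → PeriodBound k
period-bound zero = λ _ _ _ _ → z≤n
period-bound (suc zero) = λ _ _ _ hp → proj₁ hp
period-bound (suc (suc zero)) = λ _ _ _ hp → proj₁ hp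
period-bound (suc (suc (suc k))) = period-bound-step k (period-bound (suc k)) (period-bound (suc (suc k)))

least-period : ∀ k L → F (3 + k) ≤ suc L → L + 2 ≤ F (4 + k) →
  IsPeriod L (F (2 + k)) × (∀ p → IsPeriod L p → F (2 + k) ≤ p)
least-period k L c₃≤ L+2≤ = F-period k L c₂≤L L+2≤ , λ p → period-bound (2 + k) L p c₃≤
  where
  c₂≤L : F (2 + k) ≤ L
  c₂≤L = ≤-pred (≤-trans (subst (_≤ F (3 + k)) (+-comm (F (2 + k)) 1) (+-monoʳ-≤ (F (2 + k)) (F-pos k)))
                         c₃≤)

-- Lengths V with F (k+1) - 1 ≤ V ≤ F (k+3) - 2; appending F (k+2) to such a V
-- yields exactly the lengths covered by least-period.
Extendable : ℕ → ℕ → Set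
Extendable k V = F (suc k) ≤ suc V × V + 2 ≤ F (3 + k)

extension-least : ∀ k V → Extendable k V →
  IsPeriod (V + F (2 + k)) (F (2 + k)) × (∀ p → IsPeriod (V + F (2 + k)) p → F (2 + k) ≤ p)
extension-least k V (lower , upper) = least-period k (V + c)
  (subst (F (3 + k) ≤_) (reorder₁ c V) (+-monoʳ-≤ c lower))
  (subst (_≤ F (4 + k)) (reorder₂ V c) (+-monoˡ-≤ c upper))
  where
  c = F (2 + k)
  reorder₁ : ∀ c V → c + suc V ≡ suc (V + c)
  reorder₁ = solve-∀
  reorder₂ : ∀ V c → V + 2 + c ≡ V + c + 2
  reorder₂ = solve-∀

extension-periods : ∀ k V → Extendable k V → ∀ r → 1 ≤ r →
  IsPeriod (V + F (2 + k)) (F (2 + k) + r) ⇔ IsPeriod V r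
extension-periods k V ext r 1≤r =
  subst (λ M → IsPeriod (V + c) (c + r) ⇔ IsPeriod M r) (m+n∸n≡m V c)
    (period-shift (proj₁ (extension-least k V ext)) 1≤r)
  where
  c = F (2 + k)

NoAdjacentZeros : List Bool → Set
NoAdjacentZeros ds = ∀ xs ys → ds ≢ xs ++ false ∷ false ∷ ys

noAdjacentZeros-init : ∀ ys b → NoAdjacentZeros (ys ∷ʳ b) → NoAdjacentZeros ys
noAdjacentZeros-init ys b lazy xs zs e =
  lazy xs (zs ∷ʳ b) (trans (cong (_∷ʳ b) e) (++-assoc xs (false ∷ false ∷ zs) [ b ]))

noAdjacentZeros-tail : ∀ d ds → NoAdjacentZeros (d ∷ ds) → NoAdjacentZeros ds
noAdjacentZeros-tail d ds lazy xs zs e = lazy (d ∷ xs) zs (cong (d ∷_) e)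

F-weight : ∀ k → F (k + 2) ≡ F (2 + k)
F-weight k = cong F (+-comm k 2)

digit : Bool → ℕ → ℕ
digit b k = if b then F (k + 2) else 0

digit-≤ : ∀ b k → digit b k ≤ F (2 + k)
digit-≤ true k = ≤-reflexive (F-weight k)
digit-≤ false k = z≤n

valFrom-snoc : ∀ k ds b → valFrom k (ds ∷ʳ b) ≡ valFrom k ds + digit b (k + length ds)
valFrom-snoc k [] b = trans (+-identityʳ (digit b k)) (cong (digit b) (sym (+-identityʳ k)))
valFrom-snoc k (d ∷ ds) b = begin
  digit d k + valFrom (suc k) (ds ∷ʳ b)
    ≡⟨ cong (digit d k +_) (valFrom-snoc (suc k) ds b) ⟩
  digit d k + (valFrom (suc k) ds + digit b (suc k + length ds))
    ≡⟨ +-assoc (digit d k) _ _ ⟨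
  digit d k + valFrom (suc k) ds + digit b (suc k + length ds)
    ≡⟨ cong (λ n → digit d k + valFrom (suc k) ds + digit b n) (+-suc k (length ds)) ⟨
  digit d k + valFrom (suc k) ds + digit b (k + suc (length ds)) ∎

lazy-lower : ∀ k ys → NoAdjacentZeros (ys ∷ʳ true) →
  F (suc (k + length ys)) ≤ valFrom k ys + F (2 + k)
lazy-lower k [] _ rewrite +-identityʳ k = F-step (suc k)
lazy-lower k (true ∷ ys) lazy rewrite F-weight k | +-suc k (length ys) =
  -- F (k+|ys|+2) ≤ v + F (k+3) ≤ v + (c + c) = c + v + c
  ≤-trans (lazy-lower (suc k) ys (noAdjacentZeros-tail true _ lazy))
    (≤-trans (+-monoʳ-≤ v (+-monoʳ-≤ c (F-step (suc k)))) (≤-reflexive (reorder v c)))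
  where
  v = valFrom (suc k) ys
  c = F (2 + k)
  reorder : ∀ v c → v + (c + c) ≡ c + v + c
  reorder = solve-∀
lazy-lower k (false ∷ []) _ rewrite +-comm k 1 = ≤-refl
lazy-lower k (false ∷ true ∷ ys) lazy
  rewrite F-weight (suc k) | +-suc k (suc (length ys)) | +-suc k (length ys) =
  ≤-trans (lazy-lower (2 + k) ys (noAdjacentZeros-tail true _ (noAdjacentZeros-tail false _ lazy)))
          (≤-reflexive (reorder (valFrom (2 + k) ys) (F (3 + k)) (F (2 + k))))
  where
  reorder : ∀ v c₃ c₂ → v + (c₃ + c₂) ≡ 0 + (c₃ + v) + c₂
  reorder = solve-∀
lazy-lower k (false ∷ false ∷ ys) lazy = ⊥-elim (lazy [] (ys ∷ʳ true) refl)

lazy-upper : ∀ k ys → valFrom k ys + F (3 + k) ≤ F (3 + (k + length ys))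
lazy-upper k [] rewrite +-identityʳ k = ≤-refl
lazy-upper k (d ∷ ys) rewrite +-suc k (length ys) =
  -- digit + v + F (k+3) ≤ F (k+2) + v + F (k+3) = v + F (k+4) ≤ F (k+|ys|+4)
  ≤-trans (+-monoˡ-≤ (F (3 + k)) (+-monoˡ-≤ v (digit-≤ d k)))
    (≤-trans (≤-reflexive (reorder v (F (2 + k)) (F (3 + k)))) (lazy-upper (suc k) ys))
  where
  v = valFrom (suc k) ys
  reorder : ∀ v c₂ c₃ → c₂ + v + c₃ ≡ v + (c₃ + c₂)
  reorder = solve-∀

lazy-extendable : ∀ ys → NoAdjacentZeros (ys ∷ʳ true) → Extendable (length ys) (valFrom 0 ys)
lazy-extendable ys lazy =
  subst (F (suc (length ys)) ≤_) (+-comm (valFrom 0 ys) 1) (lazy-lower 0 ys lazy) , lazy-upper 0 ys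

suffixValues : ℕ → List Bool → List ℕ
suffixValues k [] = []
suffixValues k (true ∷ ds) = valFrom k (true ∷ ds) ∷ suffixValues (suc k) ds
suffixValues k (false ∷ ds) = suffixValues (suc k) ds

suffixValues-snoc-true : ∀ k ds → let c = F (k + length ds + 2) in
  suffixValues k (ds ∷ʳ true) ≡ map (_+ c) (suffixValues k ds) ++ [ c ]
suffixValues-snoc-true k [] =
  cong [_] (trans (+-identityʳ _) (cong (λ n → F (n + 2)) (sym (+-identityʳ k))))
suffixValues-snoc-true k (true ∷ ds) rewrite valFrom-snoc k (true ∷ ds) true | +-suc k (length ds) =
  cong (valFrom k (true ∷ ds) + F (suc (k + length ds) + 2) ∷_) (suffixValues-snoc-true (suc k) ds)
suffixValues-snoc-true k (false ∷ ds) rewrite +-suc k (length ds) = suffixValues-snoc-true (suc k) ds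

suffixValues-snoc-false : ∀ k ds → suffixValues k (ds ∷ʳ false) ≡ suffixValues k ds
suffixValues-snoc-false k [] = refl
suffixValues-snoc-false k (true ∷ ds) =
  cong₂ _∷_ (trans (valFrom-snoc k (true ∷ ds) false) (+-identityʳ _)) (suffixValues-snoc-false (suc k) ds)
suffixValues-snoc-false k (false ∷ ds) = suffixValues-snoc-false (suc k) ds

periods-extend : ∀ t V vs → Extendable t V → (∀ r → IsPeriod V r ⇔ r ∈ vs) →
  ∀ p → IsPeriod (V + F (2 + t)) p ⇔ p ∈ map (_+ F (2 + t)) vs ++ [ F (2 + t) ]
periods-extend t V vs ext periods p = mk⇔ to from
  where
  c = F (2 + t)
  to : IsPeriod (V + c) p → p ∈ map (_+ c) vs ++ [ c ]
  to hp with m≤n⇒∃[o]m+o≡n (proj₂ (extension-least t V ext) p hp)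
  ... | zero , c+0≡p = ∈-++⁺ʳ (map (_+ c) vs) (here (trans (sym c+0≡p) (+-identityʳ c)))
  ... | suc r , c+r≡p = ∈-++⁺ˡ (subst (_∈ map (_+ c) vs) (trans (+-comm (suc r) c) c+r≡p)
    (∈-map⁺ (_+ c) (Equivalence.to (periods (suc r)) hr)))
    where
    hr : IsPeriod V (suc r)
    hr = Equivalence.to (extension-periods t V ext (suc r) (s≤s z≤n))
           (subst (IsPeriod (V + c)) (sym c+r≡p) hp)
  from : p ∈ map (_+ c) vs ++ [ c ] → IsPeriod (V + c) p
  from p∈ with ∈-++⁻ (map (_+ c) vs) p∈
  ... | inj₂ (here p≡c) = subst (IsPeriod (V + c)) (sym p≡c) (proj₁ (extension-least t V ext))
  ... | inj₁ p∈map with ∈-map⁻ (_+ c) p∈map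
  ... | r , r∈ , p≡r+c = subst (IsPeriod (V + c)) (sym (trans p≡r+c (+-comm r c)))
    (Equivalence.from (extension-periods t V ext r (proj₁ hr)) hr)
    where
    hr : IsPeriod V r
    hr = Equivalence.from (periods r) r∈

-- The periods of the prefix whose length has lazy representation ds are the values
-- of the suffixes of ds starting with a 1.  Induction on ds from its most
-- significant end; a leading 1 is an extension step.
lazy-periods : ∀ ds → NoAdjacentZeros ds → ∀ p → IsPeriod (valFrom 0 ds) p ⇔ p ∈ suffixValues 0 ds
lazy-periods ds = go (reverseView ds)
  where
  go : ∀ {ds} → Reverse ds → NoAdjacentZeros ds →
       ∀ p → IsPeriod (valFrom 0 ds) p ⇔ p ∈ suffixValues 0 ds
  go [] _ p = mk⇔ (λ hp → ⊥-elim (empty-has-no-period p hp)) λ ()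
  go (ys ∶ rs ∶ʳ false) lazy
    rewrite valFrom-snoc 0 ys false | +-identityʳ (valFrom 0 ys) | suffixValues-snoc-false 0 ys =
    go rs (noAdjacentZeros-init ys false lazy)
  go (ys ∶ rs ∶ʳ true) lazy
    rewrite valFrom-snoc 0 ys true | suffixValues-snoc-true 0 ys | F-weight (length ys) =
    periods-extend (length ys) (valFrom 0 ys) (suffixValues 0 ys) (lazy-extendable ys lazy)
      (go rs (noAdjacentZeros-init ys true lazy))

SuffixValue : ℕ → List Bool → ℕ → Set
SuffixValue k ds p = ∃[ j ] ∃[ rest ] (drop j ds ≡ true ∷ rest × p ≡ valFrom (k + j) (true ∷ rest))

valFrom-cast : ∀ {m n} ds → m ≡ n → valFrom m ds ≡ valFrom n ds
valFrom-cast ds = cong (λ k → valFrom k ds)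

suffixValue-there : ∀ k d ds p → SuffixValue (suc k) ds p → SuffixValue k (d ∷ ds) p
suffixValue-there k d ds p (j , rest , drop≡ , p≡) =
  suc j , rest , drop≡ , trans p≡ (valFrom-cast (true ∷ rest) (sym (+-suc k j)))

∈-suffixValues⇒ : ∀ k ds p → p ∈ suffixValues k ds → SuffixValue k ds p
∈-suffixValues⇒ k (true ∷ ds) p (here p≡) =
  0 , ds , refl , trans p≡ (valFrom-cast (true ∷ ds) (sym (+-identityʳ k)))
∈-suffixValues⇒ k (true ∷ ds) p (there p∈) =
  suffixValue-there k true ds p (∈-suffixValues⇒ (suc k) ds p p∈)
∈-suffixValues⇒ k (false ∷ ds) p p∈ =
  suffixValue-there k false ds p (∈-suffixValues⇒ (suc k) ds p p∈)

∈-suffixValues⇐ : ∀ k ds p → SuffixValue k ds p → p ∈ suffixValues k ds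
∈-suffixValues⇐ k (true ∷ ds) p (zero , rest , refl , p≡) =
  here (trans p≡ (valFrom-cast (true ∷ ds) (+-identityʳ k)))
∈-suffixValues⇐ k (false ∷ ds) p (zero , rest , () , _)
∈-suffixValues⇐ k (true ∷ ds) p (suc j , rest , drop≡ , p≡) =
  there (∈-suffixValues⇐ (suc k) ds p (j , rest , drop≡ , trans p≡ (valFrom-cast (true ∷ rest) (+-suc k j))))
∈-suffixValues⇐ k (false ∷ ds) p (suc j , rest , drop≡ , p≡) =
  ∈-suffixValues⇐ (suc k) ds p (j , rest , drop≡ , trans p≡ (valFrom-cast (true ∷ rest) (+-suc k j)))

lazy-representation-periods : ∀ n ds → IsLazyRep ds n →
  ∀ p → IsPeriod n p ⇔ (∃[ j ] ∃[ rest ] (drop j ds ≡ true ∷ rest × p ≡ valFrom j (true ∷ rest)))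
lazy-representation-periods n ds (val≡n , _ , lazy) p =
  subst (λ m → IsPeriod m p ⇔ SuffixValue 0 ds p) val≡n
    (mk⇔ (∈-suffixValues⇒ 0 ds p) (∈-suffixValues⇐ 0 ds p) ⇔-∘ lazy-periods ds lazy p)

count : {P : Pred ℕ 0ℓ} → Decidable P → List ℕ → ℕ
count P? xs = length (filter P? xs)

count-++ : ∀ {P : Pred ℕ 0ℓ} (P? : Decidable P) xs ys → count P? (xs ++ ys) ≡ count P? xs + count P? ys
count-++ P? xs ys = trans (cong length (filter-++ P? xs ys)) (length-++ (filter P? xs))

count-none : ∀ {P : Pred ℕ 0ℓ} (P? : Decidable P) n f →
  (∀ i → i < n → ¬ P (f i)) → count P? (applyUpTo f n) ≡ 0
count-none P? zero f none = refl
count-none P? (suc n) f none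
  rewrite filter-reject P? {f 0} {applyUpTo (λ i → f (suc i)) n} (none 0 (s≤s z≤n)) =
  count-none P? n (λ i → f (suc i)) (λ i i< → none (suc i) (s≤s i<))

count-⇔ : ∀ {P Q : Pred ℕ 0ℓ} (P? : Decidable P) (Q? : Decidable Q) n f g →
  (∀ i → P (f i) ⇔ Q (g i)) → count P? (applyUpTo f n) ≡ count Q? (applyUpTo g n)
count-⇔ P? Q? zero f g same = refl
count-⇔ P? Q? (suc n) f g same with P? (f 0) | Q? (g 0)
... | yes _ | yes _ = cong suc (count-⇔ P? Q? n (λ i → f (suc i)) (λ i → g (suc i)) (λ i → same (suc i)))
... | no _ | no _ = count-⇔ P? Q? n (λ i → f (suc i)) (λ i → g (suc i)) (λ i → same (suc i))
... | yes p | no ¬q = ⊥-elim (¬q (Equivalence.to (same 0) p))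
... | no ¬p | yes q = ⊥-elim (¬p (Equivalence.from (same 0) q))

applyUpTo-+ : ∀ (f : ℕ → ℕ) m n → applyUpTo f (m + n) ≡ applyUpTo f m ++ applyUpTo (λ i → f (m + i)) n
applyUpTo-+ f zero n = refl
applyUpTo-+ f (suc m) n = cong (f 0 ∷_) (applyUpTo-+ (λ i → f (suc i)) m n)

-- An extension step adds exactly one period: the candidates below F (k+2) fail,
-- F (k+2) succeeds, and F (k+2) + r succeeds exactly when r is a period of f[0 .. V-1].
numPeriods-extend : ∀ k V → Extendable k V → numPeriods (V + F (2 + k)) ≡ suc (numPeriods V)
numPeriods-extend k V ext = begin
  count (isPeriod? L) (upTo (suc L))
    ≡⟨ cong (λ n → count (isPeriod? L) (upTo n)) (reorder V c) ⟩
  count (isPeriod? L) (upTo (c + suc V))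
    ≡⟨ cong (count (isPeriod? L)) (applyUpTo-+ (λ i → i) c (suc V)) ⟩
  count (isPeriod? L) (upTo c ++ applyUpTo (c +_) (suc V))
    ≡⟨ count-++ (isPeriod? L) (upTo c) _ ⟩
  count (isPeriod? L) (upTo c) + count (isPeriod? L) (applyUpTo (c +_) (suc V))
    ≡⟨ cong (_+ count (isPeriod? L) (applyUpTo (c +_) (suc V)))
            (count-none (isPeriod? L) c (λ i → i) too-short) ⟩
  count (isPeriod? L) ((c + 0) ∷ applyUpTo (λ i → c + suc i) V)
    ≡⟨ cong length (filter-accept (isPeriod? L) (subst (IsPeriod L) (sym (+-identityʳ c)) (proj₁ least))) ⟩
  suc (count (isPeriod? L) (applyUpTo (λ i → c + suc i) V))
    ≡⟨ cong suc (count-⇔ (isPeriod? L) (isPeriod? V) V (λ i → c + suc i) suc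
                   (λ i → extension-periods k V ext (suc i) (s≤s z≤n))) ⟩
  suc (count (isPeriod? V) (applyUpTo suc V))
    ≡⟨ cong (λ n → suc (length n)) (filter-reject (isPeriod? V) {0} {applyUpTo suc V} (zero-not-period V)) ⟨
  suc (numPeriods V) ∎
  where
  c = F (2 + k)
  L = V + c
  least = extension-least k V ext
  reorder : ∀ V c → suc (V + c) ≡ c + suc V
  reorder = solve-∀
  too-short : ∀ i → i < c → ¬ IsPeriod L i
  too-short i i<c hi = <⇒≱ i<c (proj₂ least i hi)

-- Every length L + 1 is obtained by an extension step from some extendable V: going
-- from L to L + 1, either V grows by one within the range for k, or V has reached
-- F (k+3) - 2 and L + 2 = (F (k+2) - 1) + F (k+3) is an extension for k + 1.
extension-decomposition : ∀ L → ∃[ k ] ∃[ V ] (suc L ≡ V + F (2 + k) × Extendable k V)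
extension-decomposition zero = 0 , 0 , refl , s≤s z≤n , s≤s (s≤s z≤n)
extension-decomposition (suc L) with extension-decomposition L
... | k , V , sucL≡ , lower , upper with suc (V + 2) ≤? F (3 + k)
...   | yes V+3≤ = k , suc V , cong suc sucL≡ , m≤n⇒m≤1+n lower , V+3≤
...   | no V+3≰ with F-suc (suc k)
...     | V′ , sucV′≡c = suc k , V′ , sucsucL≡ , ≤-reflexive (sym sucV′≡c) , V′+2≤
  where
  c = F (2 + k)
  V+2≡ : V + 2 ≡ F (3 + k)
  V+2≡ = ≤-antisym upper (≮⇒≥ V+3≰)
  reorder₁ : ∀ V V′ → suc (V + suc V′) ≡ V′ + (V + 2)
  reorder₁ = solve-∀
  sucsucL≡ : suc (suc L) ≡ V′ + F (3 + k)
  sucsucL≡ = begin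
    suc (suc L)          ≡⟨ cong suc sucL≡ ⟩
    suc (V + c)          ≡⟨ cong (λ n → suc (V + n)) sucV′≡c ⟨
    suc (V + suc V′)     ≡⟨ reorder₁ V V′ ⟩
    V′ + (V + 2)         ≡⟨ cong (V′ +_) V+2≡ ⟩
    V′ + F (3 + k)       ∎
  reorder₂ : ∀ V′ → V′ + 2 ≡ suc V′ + 1
  reorder₂ = solve-∀
  V′+2≤ : V′ + 2 ≤ F (4 + k)
  V′+2≤ = subst₂ _≤_ (sym (trans (reorder₂ V′) (cong (_+ 1) sucV′≡c))) (+-comm c (F (3 + k)))
            (+-monoʳ-≤ c (F-pos (2 + k)))

PeriodCountBounds : ℕ → ℕ → Set
PeriodCountBounds L n = F (3 + n) ≤ L + 2 × L + 1 ≤ F (2 + (n + n))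

bounds-extend : ∀ k V n → Extendable k V → PeriodCountBounds V n → PeriodCountBounds (V + F (2 + k)) (suc n)
bounds-extend k V n (lower , upper) (F≤V+2 , V+1≤F) =
  lengthen , subst (λ m → V + c + 1 ≤ F (2 + m)) (sym (+-suc (suc n) n)) shorten
  where
  c = F (2 + k)
  reorder₁ : ∀ V c → V + 2 + c ≡ V + c + 2
  reorder₁ = solve-∀
  reorder₂ : ∀ V c → c + (V + 1) ≡ V + c + 1
  reorder₂ = solve-∀
  -- F (n+3) ≤ V + 2 ≤ F (k+3) forces n ≤ k
  Fn≤c : F (2 + n) ≤ c
  Fn≤c = F-mono (≤-pred (F-reflect-≤ (3 + n) (suc k) (≤-trans F≤V+2 upper)))
  lengthen : F (4 + n) ≤ V + c + 2
  lengthen = subst (F (4 + n) ≤_) (reorder₁ V c) (+-mono-≤ F≤V+2 Fn≤c)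
  -- F (k+1) ≤ V + 1 ≤ F (2n+2) forces k ≤ 2n + 1
  c≤F : c ≤ F (3 + (n + n))
  c≤F = F-mono (s≤s (F-reflect-≤ (suc k) (n + n)
          (≤-trans lower (subst (_≤ F (2 + (n + n))) (+-comm V 1) V+1≤F))))
  shorten : V + c + 1 ≤ F (4 + (n + n))
  shorten = subst (_≤ F (4 + (n + n))) (reorder₂ V c) (+-mono-≤ c≤F V+1≤F)

-- By strong induction on L, peeling off the extension step that produces it.
period-count-bounds : ∀ L → PeriodCountBounds L (numPeriods L)
period-count-bounds = <-rec (λ L → PeriodCountBounds L (numPeriods L)) bounds
  where
  bounds : ∀ L → (∀ {M} → M < L → PeriodCountBounds M (numPeriods M)) →
           PeriodCountBounds L (numPeriods L)
  bounds zero _ = s≤s (s≤s z≤n) , s≤s z≤n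
  bounds (suc L) smaller with extension-decomposition L
  ... | k , V , sucL≡ , ext =
    subst₂ PeriodCountBounds (sym sucL≡) (sym (trans (cong numPeriods sucL≡) (numPeriods-extend k V ext)))
      (bounds-extend k V (numPeriods V) ext (smaller (subst (V <_) (sym sucL≡) (m<m+n V (F-pos (suc k))))))

-- The bounds are attained: starting from the empty prefix, extend by the smallest
-- (respectively largest) admissible amount each time.
shortest-witness : ∀ n → ∃[ X ] (X + 2 ≡ F (3 + n) × numPeriods X ≡ n)
shortest-witness zero = 0 , refl , refl
shortest-witness (suc n) with shortest-witness n
... | X , X+2≡ , count≡ =
  X + c , trans (reorder X c) (cong (_+ c) X+2≡) , trans (numPeriods-extend n X ext) (cong suc count≡)
  where
  c = F (2 + n)
  reorder : ∀ X c → X + c + 2 ≡ X + 2 + c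
  reorder = solve-∀
  ext : Extendable n X
  ext = +-cancelʳ-≤ 1 (F (suc n)) (suc X)
          (subst (F (suc n) + 1 ≤_) (trans (+-comm (F (suc n)) c) (trans (sym X+2≡) (+-suc X 1)))
            (+-monoʳ-≤ (F (suc n)) (F-pos (suc n))))
        , ≤-reflexive X+2≡

longest-witness : ∀ n → ∃[ X ] (suc X ≡ F (2 + (n + n)) × numPeriods X ≡ n)
longest-witness zero = 0 , refl , refl
longest-witness (suc n) with longest-witness n
... | X , sucX≡ , count≡ =
  X + c , subst (λ m → suc (X + c) ≡ F (2 + m)) (sym (+-suc (suc n) n)) sucX+c≡ ,
  trans (numPeriods-extend k X ext) (cong suc count≡)
  where
  k = suc (n + n)
  c = F (2 + k)
  reorder₁ : ∀ X → X + 2 ≡ suc X + 1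
  reorder₁ = solve-∀
  reorder₂ : ∀ X c → c + suc X ≡ suc (X + c)
  reorder₂ = solve-∀
  ext : Extendable k X
  ext = ≤-reflexive (sym sucX≡) ,
        subst₂ _≤_ (sym (reorder₁ X)) (trans (+-comm (suc X) c) (cong (c +_) sucX≡))
          (+-monoʳ-≤ (suc X) (F-pos (suc k)))
  sucX+c≡ : suc (X + c) ≡ F (3 + k)
  sucX+c≡ = trans (sym (reorder₂ X c)) (cong (c +_) sucX≡)

IsShortestWith : ℕ → ℕ → Set
IsShortestWith n L₀ = numPeriods L₀ ≡ n × (∀ L → numPeriods L ≡ n → L₀ ≤ L)

IsLongestWith : ℕ → ℕ → Set
IsLongestWith n L₀ = numPeriods L₀ ≡ n × (∀ L → numPeriods L ≡ n → L ≤ L₀)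

shortest-prefix : ∀ n → IsShortestWith n (F (3 + n) ∸ 2)
shortest-prefix n with shortest-witness n
... | X , X+2≡ , count≡ = subst (λ m → numPeriods m ≡ n) (sym X≡) count≡ , λ L count≡n →
  m≤n+o⇒m∸n≤o (F (3 + n)) 2 (subst (F (3 + n) ≤_) (+-comm L 2)
    (subst (λ m → F (3 + m) ≤ L + 2) count≡n (proj₁ (period-count-bounds L))))
  where
  X≡ : F (3 + n) ∸ 2 ≡ X
  X≡ = trans (cong (_∸ 2) (sym X+2≡)) (m+n∸n≡m X 2)

longest-prefix : ∀ n → IsLongestWith n (F (2 + (n + n)) ∸ 1)
longest-prefix n with longest-witness n
... | X , sucX≡ , count≡ = subst (λ m → numPeriods (m ∸ 1) ≡ n) sucX≡ count≡ , λ L count≡n →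
  m+n≤o⇒m≤o∸n L (subst (λ m → L + 1 ≤ F (2 + (m + m))) count≡n (proj₂ (period-count-bounds L)))

least-period-between : ∀ k m → F (3 + k) ∸ 1 ≤ m → m ≤ F (4 + k) ∸ 2 →
  IsPeriod m (F (2 + k)) × (∀ p → IsPeriod m p → F (2 + k) ≤ p)
least-period-between k m lower upper = least-period k m
  (≤-trans (m≤n+m∸n (F (3 + k)) 1) (s≤s lower))
  (m≤o∸n⇒m+n≤o m (F3≥2 (suc k)) upper)

corollary11 :
    -- (a)
    (∀ (n : ℕ) (ds : List Bool) → 1 ≤ n → IsLazyRep ds n →
       ∀ (p : ℕ) → IsPeriod n p ⇔ (∃[ j ] ∃[ rest ] (drop j ds ≡ true ∷ rest × p ≡ valFrom j (true ∷ rest))))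
    -- (b)
    × (∀ (n : ℕ) → 1 ≤ n →
       numPeriods (F (n + 3) ∸ 2) ≡ n × (∀ L → numPeriods L ≡ n → F (n + 3) ∸ 2 ≤ L))
    -- (c)
    × (∀ (n : ℕ) → 1 ≤ n →
       numPeriods (F (2 * n + 2) ∸ 1) ≡ n × (∀ L → numPeriods L ≡ n → L ≤ F (2 * n + 2) ∸ 1))
    -- (d)
    × (∀ (n m : ℕ) → 2 ≤ n → F (n + 1) ∸ 1 ≤ m → m ≤ F (n + 2) ∸ 2 →
       IsPeriod m (F n) × (∀ p → IsPeriod m p → F n ≤ p))
corollary11 = (λ n ds _ → lazy-representation-periods n ds) , part-b , part-c , part-d
  where
  3+n≡ : ∀ n → 3 + n ≡ n + 3
  3+n≡ = solve-∀
  2+2n≡ : ∀ n → 2 + (n + n) ≡ 2 * n + 2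
  2+2n≡ = solve-∀
  part-b : ∀ n → 1 ≤ n → IsShortestWith n (F (n + 3) ∸ 2)
  part-b n _ = subst (λ i → IsShortestWith n (F i ∸ 2)) (3+n≡ n) (shortest-prefix n)
  part-c : ∀ n → 1 ≤ n → IsLongestWith n (F (2 * n + 2) ∸ 1)
  part-c n _ = subst (λ i → IsLongestWith n (F i ∸ 1)) (2+2n≡ n) (longest-prefix n)
  part-d : ∀ n m → 2 ≤ n → F (n + 1) ∸ 1 ≤ m → m ≤ F (n + 2) ∸ 2 →
           IsPeriod m (F n) × (∀ p → IsPeriod m p → F n ≤ p)
  part-d (suc (suc k)) m (s≤s (s≤s _)) lower upper = least-period-between k m
    (subst (λ i → F (2 + i) ∸ 1 ≤ m) (+-comm k 1) lower)
    (subst (λ i → m ≤ F (2 + i) ∸ 2) (+-comm k 2) upper)
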